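{- Define a sequence $(a_{0,l})_{l\ge 1}$ by $a_{0,1}=1$ and, for $l\ge 2$, \[ a_{0,l}=2(5l-6)(5l-4)\,a_{0,l-1}+\sum_{j=1}^{l-1}a_{0,j}\,a_{0,l-j}, \] and set $\alpha_n=50^{ -n}a_{0,n}$ for $n\ge 1$. Define a sequence $(b_g)_{g\ge 0}$ by $b_0=1$ and, for $g\ge 0$, \[ b_{g+1}=\frac{25g^2-1}{48}\,b_g-\frac12\sum_{m=1}^{g}b_m\,b_{g+1-m}, \] and set $\beta_g=-\frac12\left(\frac{25}{48}\right)^{ -g}b_g$ for $g\ge 1$. Then $\alpha_n=\beta_n$ for every $n\ge 1$; equivalently, $a_{0,n}=-\tfrac12\,96^{n}\,b_n$ for all $n\ge 1$.
   Context: The sequence $a_{0,\cdot}$ is the $k=0$ slice of the two-index sequence $a_{k,l}$ governing the joint moments of the limiting internal and ancestral path lengths of random binary trees; the sequence $b_g$ arises in the asymptotic enumeration of rooted maps on orientable surfaces of genus $g$. Both sequences are fully specified by the recurrences in the claim (empty sums are zero). -}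

module Defs where

open import Data.Nat as ℕ using (ℕ; zero; suc; _≡ᵇ_)
open import Data.Bool using (if_then_else_)
open import Data.Integer using (+_)
open import Data.Rational as ℚ using (ℚ; _/_; ½; -_; 1ℚ; 0ℚ)

sumℕ : ℕ → (ℕ → ℕ) → ℕ
sumℕ zero    f = 0
sumℕ (suc m) f = sumℕ m f ℕ.+ f (suc m)

sumℚ : ℕ → (ℕ → ℚ) → ℚ
sumℚ zero    f = 0ℚ
sumℚ (suc m) f = sumℚ m f ℚ.+ f (suc m)

powℚ : ℚ → ℕ → ℚ
powℚ q zero    = 1ℚ
powℚ q (suc n) = q ℚ.* powℚ q n

aStep : (ℕ → ℕ) → ℕ → ℕ
aStep f zero          = 0   -- index 0 unused
aStep f (suc zero)    = 1
aStep f l@(suc (suc k)) =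
  2 ℕ.* ((5 ℕ.* l ℕ.∸ 6) ℕ.* (5 ℕ.* l ℕ.∸ 4)) ℕ.* f (suc k)
  ℕ.+ sumℕ (suc k) (λ j → f j ℕ.* f (l ℕ.∸ j))

-- aTable n i = a_{0,i} for all 1 ≤ i ≤ n
aTable : ℕ → ℕ → ℕ
aTable zero    = λ _ → 0
aTable (suc n) = λ i → if i ≡ᵇ suc n then aStep (aTable n) (suc n) else aTable n i

a0 : ℕ → ℕ
a0 l = aTable l l

bStep : (ℕ → ℚ) → ℕ → ℚ
bStep f zero    = 1ℚ
bStep f (suc g) =
  ((+ (25 ℕ.* g ℕ.* g) ℚ./ 1 ℚ.- 1ℚ) ℚ.* (+ 1 / 48)) ℚ.* f g
  ℚ.- ½ ℚ.* sumℚ g (λ m → f m ℚ.* f (suc g ℕ.∸ m))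

-- bTable n i = b_i for all 0 ≤ i ≤ n
bTable : ℕ → ℕ → ℚ
bTable zero    = λ i → bStep (λ _ → 0ℚ) 0
bTable (suc n) = λ i → if i ≡ᵇ suc n then bStep (bTable n) (suc n) else bTable n i

b : ℕ → ℚ
b g = bTable g g

α : ℕ → ℚ
α n = powℚ (+ 1 / 50) n ℚ.* ((+ a0 n) / 1)

β : ℕ → ℚ
β g = (- ½) ℚ.* powℚ (+ 48 / 25) g ℚ.* b g

-- Substituting -½ 96ⁿ b_n for a_{0,n} turns the b-recurrence into the a-recurrence:
-- the coefficients match because (5l-6)(5l-4) + 1 = 25(l-1)², and the convolution
-- terms match because the weight 96^j 96^{l-j} = 96^l does not depend on j.  Strong
-- induction finishes, and 96/50 = 48/25 converts the identity into α = β.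
module Submission where

open import Defs
open import Data.Nat using (ℕ; suc)
open import Relation.Binary.PropositionalEquality using (_≡_)

open import Data.Nat as ℕ using (zero; _≡ᵇ_; _≤_; _<_; _∸_; z≤n; s≤s)
import Data.Nat.Properties as ℕP
open import Data.Nat.Induction using (<-rec)
import Data.Nat.Solver
import Data.Nat.Coprimality as Coprimality
open import Data.Bool using (true; false; if_then_else_)
open import Data.Sum using (inj₁; inj₂)
open import Data.Integer as ℤ using (+_)
import Data.Integer.Properties as ℤP
open import Data.Rational as ℚ using (ℚ; _/_; ½; -_; 1ℚ; mkℚ)
import Data.Rational.Properties as ℚP
import Data.Rational.Solver
open import Relation.Binary.PropositionalEquality
  using (refl; sym; trans; cong; cong₂; module ≡-Reasoning)

module ℚ-Solver = Data.Rational.Solver.+-*-Solver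

ι : ℕ → ℚ
ι n = + n / 1

ι-mkℚ : ∀ n → ι n ≡ mkℚ (+ n) 0 (Coprimality.sym (Coprimality.1-coprimeTo n))
ι-mkℚ n = ℚP.normalize-coprime (Coprimality.sym (Coprimality.1-coprimeTo n))

ι-+ : ∀ m n → ι (m ℕ.+ n) ≡ ι m ℚ.+ ι n
ι-+ m n rewrite ι-mkℚ m | ι-mkℚ n =
  cong (_/ 1) (sym (cong₂ ℤ._+_ (ℤP.*-identityʳ (+ m)) (ℤP.*-identityʳ (+ n))))

ι-* : ∀ m n → ι (m ℕ.* n) ≡ ι m ℚ.* ι n
ι-* m n rewrite ι-mkℚ m | ι-mkℚ n = cong (_/ 1) (ℤP.pos-* m n)

sumℕ-cong : ∀ m {f g : ℕ → ℕ} → (∀ j → 1 ≤ j → j ≤ m → f j ≡ g j) → sumℕ m f ≡ sumℕ m g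
sumℕ-cong zero    f≗g = refl
sumℕ-cong (suc m) f≗g =
  cong₂ ℕ._+_ (sumℕ-cong m (λ j 1≤j j≤m → f≗g j 1≤j (ℕP.m≤n⇒m≤1+n j≤m))) (f≗g (suc m) (s≤s z≤n) ℕP.≤-refl)

sumℚ-cong : ∀ m {f g : ℕ → ℚ} → (∀ j → 1 ≤ j → j ≤ m → f j ≡ g j) → sumℚ m f ≡ sumℚ m g
sumℚ-cong zero    f≗g = refl
sumℚ-cong (suc m) f≗g =
  cong₂ ℚ._+_ (sumℚ-cong m (λ j 1≤j j≤m → f≗g j 1≤j (ℕP.m≤n⇒m≤1+n j≤m))) (f≗g (suc m) (s≤s z≤n) ℕP.≤-refl)

ι-sumℕ : ∀ m (f : ℕ → ℕ) → ι (sumℕ m f) ≡ sumℚ m (λ j → ι (f j))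
ι-sumℕ zero    f = refl
ι-sumℕ (suc m) f = trans (ι-+ (sumℕ m f) (f (suc m))) (cong (ℚ._+ ι (f (suc m))) (ι-sumℕ m f))

sumℚ-*ˡ : ∀ m x (f : ℕ → ℚ) → sumℚ m (λ j → x ℚ.* f j) ≡ x ℚ.* sumℚ m f
sumℚ-*ˡ zero    x f = sym (ℚP.*-zeroʳ x)
sumℚ-*ˡ (suc m) x f =
  trans (cong (ℚ._+ (x ℚ.* f (suc m))) (sumℚ-*ˡ m x f)) (sym (ℚP.*-distribˡ-+ x (sumℚ m f) (f (suc m))))

powℚ-distribˡ-+-* : ∀ q m n → powℚ q (m ℕ.+ n) ≡ powℚ q m ℚ.* powℚ q n
powℚ-distribˡ-+-* q zero    n = sym (ℚP.*-identityˡ (powℚ q n))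
powℚ-distribˡ-+-* q (suc m) n =
  trans (cong (q ℚ.*_) (powℚ-distribˡ-+-* q m n)) (sym (ℚP.*-assoc q (powℚ q m) (powℚ q n)))

powℚ-distribʳ-* : ∀ p q m → powℚ (p ℚ.* q) m ≡ powℚ p m ℚ.* powℚ q m
powℚ-distribʳ-* p q zero    = refl
powℚ-distribʳ-* p q (suc m) =
  trans (cong ((p ℚ.* q) ℚ.*_) (powℚ-distribʳ-* p q m))
        (ℚ-Solver.solve 4 (λ p q x y → (p :* q) :* (x :* y) := (p :* x) :* (q :* y)) refl
           p q (powℚ p m) (powℚ q m))
  where open ℚ-Solver

convℕ : (ℕ → ℕ) → ℕ → ℕ
convℕ f m = sumℕ m (λ j → f j ℕ.* f (suc m ∸ j))

convℚ : (ℕ → ℚ) → ℕ → ℚ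
convℚ f m = sumℚ m (λ j → f j ℚ.* f (suc m ∸ j))

1≤1+m∸j : ∀ {m j} → j ≤ m → 1 ≤ suc m ∸ j
1≤1+m∸j j≤m = ℕP.m<n⇒0<n∸m (s≤s j≤m)

1+m∸j≤m : ∀ {m j} → 1 ≤ j → suc m ∸ j ≤ m
1+m∸j≤m {m} 1≤j = ℕP.∸-monoʳ-≤ (suc m) 1≤j

convℕ-cong : ∀ m {f g : ℕ → ℕ} → (∀ j → 1 ≤ j → j ≤ m → f j ≡ g j) → convℕ f m ≡ convℕ g m
convℕ-cong m f≗g = sumℕ-cong m λ j 1≤j j≤m →
  cong₂ ℕ._*_ (f≗g j 1≤j j≤m) (f≗g (suc m ∸ j) (1≤1+m∸j j≤m) (1+m∸j≤m 1≤j))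

convℚ-cong : ∀ m {f g : ℕ → ℚ} → (∀ j → 1 ≤ j → j ≤ m → f j ≡ g j) → convℚ f m ≡ convℚ g m
convℚ-cong m f≗g = sumℚ-cong m λ j 1≤j j≤m →
  cong₂ ℚ._*_ (f≗g j 1≤j j≤m) (f≗g (suc m ∸ j) (1≤1+m∸j j≤m) (1+m∸j≤m 1≤j))

ι-convℕ : ∀ m (f : ℕ → ℕ) → ι (convℕ f m) ≡ convℚ (λ j → ι (f j)) m
ι-convℕ m f = trans (ι-sumℕ m _) (sumℚ-cong m λ j _ _ → ι-* (f j) (f (suc m ∸ j)))

convℚ-geometric : ∀ κ q (h : ℕ → ℚ) m →
  convℚ (λ j → κ ℚ.* powℚ q j ℚ.* h j) m ≡ κ ℚ.* κ ℚ.* powℚ q (suc m) ℚ.* convℚ h m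
convℚ-geometric κ q h m =
  trans (sumℚ-cong m λ j _ j≤m → weight j (ℕP.m≤n⇒m≤1+n j≤m))
        (sumℚ-*ˡ m (κ ℚ.* κ ℚ.* powℚ q (suc m)) (λ j → h j ℚ.* h (suc m ∸ j)))
  where
  open ≡-Reasoning
  weight : ∀ j → j ≤ suc m →
    κ ℚ.* powℚ q j ℚ.* h j ℚ.* (κ ℚ.* powℚ q (suc m ∸ j) ℚ.* h (suc m ∸ j))
      ≡ κ ℚ.* κ ℚ.* powℚ q (suc m) ℚ.* (h j ℚ.* h (suc m ∸ j))
  weight j j≤1+m = begin
    κ ℚ.* powℚ q j ℚ.* h j ℚ.* (κ ℚ.* powℚ q (suc m ∸ j) ℚ.* h (suc m ∸ j))
      ≡⟨ ℚ-Solver.solve 5 (λ κ x y u v → κ :* x :* u :* (κ :* y :* v) := κ :* κ :* (x :* y) :* (u :* v)) refl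
           κ (powℚ q j) (powℚ q (suc m ∸ j)) (h j) (h (suc m ∸ j)) ⟩
    κ ℚ.* κ ℚ.* (powℚ q j ℚ.* powℚ q (suc m ∸ j)) ℚ.* (h j ℚ.* h (suc m ∸ j))
      ≡⟨ cong (λ z → κ ℚ.* κ ℚ.* z ℚ.* (h j ℚ.* h (suc m ∸ j))) (sym (powℚ-distribˡ-+-* q j (suc m ∸ j))) ⟩
    κ ℚ.* κ ℚ.* powℚ q (j ℕ.+ (suc m ∸ j)) ℚ.* (h j ℚ.* h (suc m ∸ j))
      ≡⟨ cong (λ n → κ ℚ.* κ ℚ.* powℚ q n ℚ.* (h j ℚ.* h (suc m ∸ j))) (ℕP.m+[n∸m]≡n j≤1+m) ⟩
    κ ℚ.* κ ℚ.* powℚ q (suc m) ℚ.* (h j ℚ.* h (suc m ∸ j)) ∎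
    where open ℚ-Solver

≡ᵇ-refl : ∀ n → (n ≡ᵇ n) ≡ true
≡ᵇ-refl zero    = refl
≡ᵇ-refl (suc n) = ≡ᵇ-refl n

≤⇒≡ᵇ-suc-false : ∀ {i n} → i ≤ n → (i ≡ᵇ suc n) ≡ false
≤⇒≡ᵇ-suc-false z≤n       = refl
≤⇒≡ᵇ-suc-false (s≤s i≤n) = ≤⇒≡ᵇ-suc-false i≤n

-- T n is the table of the first n values of a course-of-values recursion; the
-- sequence itself is read off the diagonal.
module Diagonal {A : Set} (T : ℕ → ℕ → A) (step : (ℕ → A) → ℕ → A)
  (T-suc : ∀ n i → T (suc n) i ≡ (if i ≡ᵇ suc n then step (T n) (suc n) else T n i)) where

  diagonal-stable : ∀ {n i} → i ≤ n → T n i ≡ T i i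
  diagonal-stable {zero}  z≤n = refl
  diagonal-stable {suc n} {i} i≤1+n with ℕP.m≤n⇒m<n∨m≡n i≤1+n
  ... | inj₂ refl      = refl
  ... | inj₁ (s≤s i≤n) rewrite T-suc n i | ≤⇒≡ᵇ-suc-false i≤n = diagonal-stable i≤n

  diagonal-step : (∀ n {f g} → (∀ j → j < n → f j ≡ g j) → step f n ≡ step g n) →
    ∀ n → T (suc n) (suc n) ≡ step (λ i → T i i) (suc n)
  diagonal-step step-local n rewrite T-suc n (suc n) | ≡ᵇ-refl n =
    step-local (suc n) λ j j<1+n → diagonal-stable (ℕ.s≤s⁻¹ j<1+n)

aCoeff : ℕ → ℕ
aCoeff l = (5 ℕ.* l ∸ 6) ℕ.* (5 ℕ.* l ∸ 4)

aCoeff+1 : ∀ k → aCoeff (suc (suc k)) ℕ.+ 1 ≡ 25 ℕ.* suc k ℕ.* suc k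
aCoeff+1 k = begin
  aCoeff (suc (suc k)) ℕ.+ 1
    ≡⟨ cong₂ (λ x y → x ℕ.* y ℕ.+ 1) 5[2+k]∸6 5[2+k]∸4 ⟩
  (5 ℕ.* k ℕ.+ 4) ℕ.* (5 ℕ.* k ℕ.+ 6) ℕ.+ 1
    ≡⟨ solve 1 (λ k → (con 5 :* k :+ con 4) :* (con 5 :* k :+ con 6) :+ con 1
                        := con 25 :* (con 1 :+ k) :* (con 1 :+ k)) refl k ⟩
  25 ℕ.* suc k ℕ.* suc k ∎
  where
  open ≡-Reasoning
  open Data.Nat.Solver.+-*-Solver
  5[2+k]∸6 : 5 ℕ.* suc (suc k) ∸ 6 ≡ 5 ℕ.* k ℕ.+ 4
  5[2+k]∸6 = trans (cong (_∸ 6) (solve 1 (λ k → con 5 :* (con 2 :+ k) := (con 5 :* k :+ con 4) :+ con 6) refl k))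
                   (ℕP.m+n∸n≡m (5 ℕ.* k ℕ.+ 4) 6)
  5[2+k]∸4 : 5 ℕ.* suc (suc k) ∸ 4 ≡ 5 ℕ.* k ℕ.+ 6
  5[2+k]∸4 = trans (cong (_∸ 4) (solve 1 (λ k → con 5 :* (con 2 :+ k) := (con 5 :* k :+ con 6) :+ con 4) refl k))
                   (ℕP.m+n∸n≡m (5 ℕ.* k ℕ.+ 6) 4)

aStep-local : ∀ l {f g : ℕ → ℕ} → (∀ j → j < l → f j ≡ g j) → aStep f l ≡ aStep g l
aStep-local zero                f≗g = refl
aStep-local (suc zero)          f≗g = refl
aStep-local (suc (suc k)) {f} {g} f≗g =
  cong₂ ℕ._+_ (cong (2 ℕ.* aCoeff (suc (suc k)) ℕ.*_) (f≗g (suc k) ℕP.≤-refl))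
              (convℕ-cong (suc k) λ j _ j≤1+k → f≗g j (s≤s j≤1+k))

bStep-local : ∀ l {f g : ℕ → ℚ} → (∀ j → j < l → f j ≡ g j) → bStep f l ≡ bStep g l
bStep-local zero    f≗g = refl
bStep-local (suc g) f≗g =
  cong₂ ℚ._-_ (cong ((ι (25 ℕ.* g ℕ.* g) ℚ.- 1ℚ) ℚ.* (+ 1 / 48) ℚ.*_) (f≗g g ℕP.≤-refl))
              (cong (½ ℚ.*_) (convℚ-cong g λ j _ j≤g → f≗g j (s≤s j≤g)))

a0-step : ∀ n → a0 (suc n) ≡ aStep a0 (suc n)
a0-step = Diagonal.diagonal-step aTable aStep (λ _ _ → refl) aStep-local

b-step : ∀ g → b (suc g) ≡ bStep b (suc g)
b-step = Diagonal.diagonal-step bTable bStep (λ _ _ → refl) bStep-local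

rescaledB : ℕ → ℚ
rescaledB n = (- ½) ℚ.* powℚ (ι 96) n ℚ.* b n

ι-aStep : ∀ k (f : ℕ → ℕ) →
  ι (aStep f (suc (suc k))) ≡ ι 2 ℚ.* ι (aCoeff (suc (suc k))) ℚ.* ι (f (suc k)) ℚ.+ convℚ (λ j → ι (f j)) (suc k)
ι-aStep k f = begin
  ι (2 ℕ.* aCoeff (suc (suc k)) ℕ.* f (suc k) ℕ.+ convℕ f (suc k))
    ≡⟨ ι-+ (2 ℕ.* aCoeff (suc (suc k)) ℕ.* f (suc k)) (convℕ f (suc k)) ⟩
  ι (2 ℕ.* aCoeff (suc (suc k)) ℕ.* f (suc k)) ℚ.+ ι (convℕ f (suc k))
    ≡⟨ cong₂ ℚ._+_ (trans (ι-* (2 ℕ.* aCoeff (suc (suc k))) (f (suc k)))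
                          (cong (ℚ._* ι (f (suc k))) (ι-* 2 (aCoeff (suc (suc k))))))
                   (ι-convℕ (suc k) f) ⟩
  ι 2 ℚ.* ι (aCoeff (suc (suc k))) ℚ.* ι (f (suc k)) ℚ.+ convℚ (λ j → ι (f j)) (suc k) ∎
  where open ≡-Reasoning

rescaledB-step : ∀ k →
  rescaledB (suc (suc k)) ≡ ι 2 ℚ.* ι (aCoeff (suc (suc k))) ℚ.* rescaledB (suc k) ℚ.+ convℚ rescaledB (suc k)
rescaledB-step k = begin
  (- ½) ℚ.* (ι 96 ℚ.* P) ℚ.* b (suc g)
    ≡⟨ cong ((- ½) ℚ.* (ι 96 ℚ.* P) ℚ.*_) (b-step g) ⟩
  (- ½) ℚ.* (ι 96 ℚ.* P) ℚ.* ((ι (25 ℕ.* g ℕ.* g) ℚ.- 1ℚ) ℚ.* (+ 1 / 48) ℚ.* b g ℚ.- ½ ℚ.* convℚ b g)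
    ≡⟨ cong (λ z → (- ½) ℚ.* (ι 96 ℚ.* P) ℚ.* ((z ℚ.- 1ℚ) ℚ.* (+ 1 / 48) ℚ.* b g ℚ.- ½ ℚ.* convℚ b g))
            (trans (cong ι (sym (aCoeff+1 k))) (ι-+ X 1)) ⟩
  (- ½) ℚ.* (ι 96 ℚ.* P) ℚ.* ((ι X ℚ.+ 1ℚ ℚ.- 1ℚ) ℚ.* (+ 1 / 48) ℚ.* b g ℚ.- ½ ℚ.* convℚ b g)
    ≡⟨ solve 4 (λ x p u s →
         con (- ½) :* (con (ι 96) :* p) :* ((x :+ con 1ℚ :- con 1ℚ) :* con (+ 1 / 48) :* u :- con ½ :* s)
         := con (ι 2) :* x :* (con (- ½) :* p :* u) :+ con (- ½) :* con (- ½) :* (con (ι 96) :* p) :* s)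
         refl (ι X) P (b g) (convℚ b g) ⟩
  ι 2 ℚ.* ι X ℚ.* rescaledB g ℚ.+ (- ½) ℚ.* (- ½) ℚ.* powℚ (ι 96) (suc g) ℚ.* convℚ b g
    ≡⟨ cong (ι 2 ℚ.* ι X ℚ.* rescaledB g ℚ.+_) (convℚ-geometric (- ½) (ι 96) b g) ⟨
  ι 2 ℚ.* ι X ℚ.* rescaledB g ℚ.+ convℚ rescaledB g ∎
  where
  open ≡-Reasoning
  open ℚ-Solver
  g = suc k
  X = aCoeff (suc (suc k))
  P = powℚ (ι 96) g

ι-a0≡rescaledB : ∀ n → 1 ≤ n → ι (a0 n) ≡ rescaledB n
ι-a0≡rescaledB = <-rec _ step
  where
  open ≡-Reasoning
  step : ∀ n → (∀ {i} → i < n → 1 ≤ i → ι (a0 i) ≡ rescaledB i) → 1 ≤ n → ι (a0 n) ≡ rescaledB n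
  step (suc zero)    _  _ = refl
  step (suc (suc k)) ih _ = begin
    ι (a0 (suc (suc k)))
      ≡⟨ cong ι (a0-step (suc k)) ⟩
    ι (aStep a0 (suc (suc k)))
      ≡⟨ ι-aStep k a0 ⟩
    ι 2 ℚ.* ι (aCoeff (suc (suc k))) ℚ.* ι (a0 (suc k)) ℚ.+ convℚ (λ j → ι (a0 j)) (suc k)
      ≡⟨ cong₂ ℚ._+_ (cong (ι 2 ℚ.* ι (aCoeff (suc (suc k))) ℚ.*_) (ih ℕP.≤-refl (s≤s z≤n)))
                     (convℚ-cong (suc k) λ j 1≤j j≤1+k → ih (s≤s j≤1+k) 1≤j) ⟩
    ι 2 ℚ.* ι (aCoeff (suc (suc k))) ℚ.* rescaledB (suc k) ℚ.+ convℚ rescaledB (suc k)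
      ≡⟨ rescaledB-step k ⟨
    rescaledB (suc (suc k)) ∎

mainTheorem1 : (n : ℕ) → α (suc n) ≡ β (suc n)
mainTheorem1 n = begin
  powℚ (+ 1 / 50) m ℚ.* ι (a0 m)
    ≡⟨ cong (powℚ (+ 1 / 50) m ℚ.*_) (ι-a0≡rescaledB m (s≤s z≤n)) ⟩
  powℚ (+ 1 / 50) m ℚ.* ((- ½) ℚ.* powℚ (ι 96) m ℚ.* b m)
    ≡⟨ solve 3 (λ x y u → x :* (con (- ½) :* y :* u) := con (- ½) :* (x :* y) :* u) refl
         (powℚ (+ 1 / 50) m) (powℚ (ι 96) m) (b m) ⟩
  (- ½) ℚ.* (powℚ (+ 1 / 50) m ℚ.* powℚ (ι 96) m) ℚ.* b m
    ≡⟨ cong (λ z → (- ½) ℚ.* z ℚ.* b m) (powℚ-distribʳ-* (+ 1 / 50) (ι 96) m) ⟨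
  (- ½) ℚ.* powℚ (+ 48 / 25) m ℚ.* b m ∎
  where
  open ≡-Reasoning
  open ℚ-Solver
  m = suc n
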